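{- For every integer $n\ge 6$, $$m_2^{ - }(n,3)\le\begin{cases} n(n-2)/2, & \text{if } n \text{ is even},\\ (n-1)(n-2)/2, & \text{if } n \text{ is odd}.\end{cases}$$
   Context: The Johnson graph $J(n,3)$ has as vertices the $3$-element subsets of $\{1,\ldots,n\}$, adjacent iff their intersection has size $2$. $V_2$ is the eigenspace of its adjacency matrix for the eigenvalue $\lambda_2(n,3)=n-7$. For a real vector $v$ indexed by vertices, $X_-(v)=\{x:v_x<0\}$, $X_0(v)=\{x:v_x=0\}$, and $m_2^-(n,3)=\min\{|X_-(v)|: v\in V_2,\ X_0(v)=\emptyset\}$. -}

module Defs where

open import Data.Nat as ℕ using (ℕ; zero; suc; _∸_; _%_; _/_)
open import Data.Integer as ℤ using (ℤ)
open import Data.Rational as ℚ using (ℚ; 0ℚ)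
open import Data.Rational.Properties using (_<?_)
open import Data.Fin.Subset using (Subset; inside; outside; ∣_∣; _∩_)
open import Data.Vec using ([]; _∷_)
open import Data.List using (List; []; _∷_; _++_; map; filter; foldr; length)
open import Data.List.Membership.Propositional using (_∈_)
open import Relation.Binary.PropositionalEquality using (_≡_; _≢_)
open import Data.Product using (Σ; _×_)

allSubsets : (n : ℕ) → List (Subset n)
allSubsets zero = [] ∷ []
allSubsets (suc n) = map (inside ∷_) (allSubsets n) ++ map (outside ∷_) (allSubsets n)

J3vertices : (n : ℕ) → List (Subset n)
J3vertices n = filter (λ s → ∣ s ∣ ℕ.≟ 3) (allSubsets n)

Adj : {n : ℕ} → Subset n → Subset n → Set
Adj x y = ∣ x ∩ y ∣ ≡ 2

sumℚ : List ℚ → ℚ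
sumℚ = foldr ℚ._+_ 0ℚ

adjApply : (n : ℕ) → (Subset n → ℚ) → Subset n → ℚ
adjApply n v x = sumℚ (map v (filter (λ y → ∣ x ∩ y ∣ ℕ.≟ 2) (J3vertices n)))

lambda2 : ℕ → ℚ
lambda2 n = (ℤ.+ n ℚ./ 1) ℚ.- (ℤ.+ 7 ℚ./ 1)

InV2 : (n : ℕ) → (Subset n → ℚ) → Set
InV2 n v = ∀ x → x ∈ J3vertices n → adjApply n v x ≡ lambda2 n ℚ.* v x

NoZeros : (n : ℕ) → (Subset n → ℚ) → Set
NoZeros n v = ∀ x → x ∈ J3vertices n → v x ≢ 0ℚ

numNeg : (n : ℕ) → (Subset n → ℚ) → ℕ
numNeg n v = length (filter (λ x → v x <? 0ℚ) (J3vertices n))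

boundAux : ℕ → ℕ → ℕ
boundAux n zero = (n ℕ.* (n ∸ 2)) / 2
boundAux n (suc _) = ((n ∸ 1) ℕ.* (n ∸ 2)) / 2

bound : ℕ → ℕ
bound n = boundAux n (n % 2)

module Submission where

-- Split the points into consecutive pairs (for odd n, all but a first apex point 0) and let
-- m(y) be the number of pairs contained in the triple y. The vector v = 3 − (n−1)·m for
-- even n, and v = 3 − 2·[0 ∈ y] − (n−2)·m for odd n, has no zero entry and is negative
-- only on the k(n−2) triples containing a pair, which is the bound. It lies in V₂ by
-- counting: a pair inside a triple x lies in n−3 neighbours of x and a pair meeting x
-- once lies in 2 of them, so Σ_{y∼x} m(y) = (n−7)·m(x) + 6 − 2·[0 ∈ x]; together with
-- Σ_{y∼x} [0 ∈ y] = 3 + (2n−9)·[0 ∈ x] and the 3(n−3) neighbours of x this gives Av = (n−7)v.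
-- The neighbour sums are computed by recursion along the pairs, after sorting the
-- subsets y by how many points of x they delete and how many they insert.

open import Defs
open import Data.Nat using (ℕ; _≤_)
open import Data.Rational using (ℚ)
open import Data.Fin.Subset using (Subset)
open import Data.Product using (Σ; _×_)

open import Data.Bool using (Bool; true; false; if_then_else_)
open import Data.Empty using (⊥-elim)
open import Data.Fin.Subset using (∣_∣; _∩_; _─_; ∁)
open import Data.Fin.Subset.Properties using (∩-comm; ∣p∣≤n; ∣∁p∣≡n∸∣p∣)
open import Data.Integer as ℤ using (ℤ)
import Data.Integer.Properties as ℤ
import Data.Integer.Tactic.RingSolver as ℤ-Solver
open import Data.List using (List; []; _∷_; _++_; map; filter; length)
open import Data.List.Membership.Propositional using (_∈_)
open import Data.List.Membership.Propositional.Properties using (∈-filter⁻)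
open import Data.List.Properties using (map-++; map-∘)
open import Data.Nat using (zero; suc; _+_; _*_; _∸_; _<_; _%_; _/_; z≤n; s≤s)
open import Data.Nat.Combinatorics using (_C_; nCk+nC[k+1]≡[n+1]C[k+1]; nC1≡n; k>n⇒nCk≡0)
open import Data.Nat.DivMod using (m*n%n≡0; [m+kn]%n≡m%n; m*n/n≡m)
import Data.Nat.GCD as ℕ
open import Data.Nat.ListAction using (sum)
open import Data.Nat.ListAction.Properties using (sum-++)
import Data.Nat.Properties as ℕ
open import Data.Nat.Tactic.RingSolver using (solve-∀)
open import Data.Product using (_,_; proj₂)
import Data.Rational as ℚ
open import Data.Rational using (0ℚ)
import Data.Rational.Properties as ℚ
open import Data.Sum using (_⊎_; inj₁; inj₂)
open import Data.Vec using ([]; _∷_)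
open import Relation.Binary.PropositionalEquality
open import Relation.Nullary using (Dec; does; yes; no)
open import Relation.Nullary.Decidable using (toWitness)

fromℤ : ℤ → ℚ
fromℤ i = i ℚ./ 1

↥-fromℤ : ∀ i → ℚ.↥ fromℤ i ≡ i
↥-fromℤ i = trans (sym (ℤ.*-identityʳ _))
  (trans (cong (λ g → ℚ.↥ fromℤ i ℤ.* ℤ.+ g) (sym (ℕ.gcd-zeroʳ ℤ.∣ i ∣))) (ℚ.↥-/ i 1))

↧-fromℤ : ∀ i → ℚ.↧ fromℤ i ≡ ℤ.+ 1
↧-fromℤ i = trans (sym (ℤ.*-identityʳ _))
  (trans (cong (λ g → ℚ.↧ fromℤ i ℤ.* ℤ.+ g) (sym (ℕ.gcd-zeroʳ ℤ.∣ i ∣))) (ℚ.↧-/ i 1))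

↧ₙ-fromℤ : ∀ i → ℚ.↧ₙ fromℤ i ≡ 1
↧ₙ-fromℤ i = cong ℤ.∣_∣ (↧-fromℤ i)

fromℤ-injective : ∀ {i j} → fromℤ i ≡ fromℤ j → i ≡ j
fromℤ-injective {i} {j} eq = trans (sym (↥-fromℤ i)) (trans (cong ℚ.↥_ eq) (↥-fromℤ j))

fromℤ-+ : ∀ i j → fromℤ i ℚ.+ fromℤ j ≡ fromℤ (i ℤ.+ j)
fromℤ-+ i j = trans (unfold (fromℤ i) (fromℤ j)) (ℚ./-cong numerator denominator)
  where
  unfold : ∀ p q → p ℚ.+ q ≡ (ℚ.↥ p ℤ.* ℚ.↧ q ℤ.+ ℚ.↥ q ℤ.* ℚ.↧ p) ℚ./ (ℚ.↧ₙ p * ℚ.↧ₙ q)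
  unfold (ℚ.mkℚ _ _ _) (ℚ.mkℚ _ _ _) = refl
  numerator : ℚ.↥ fromℤ i ℤ.* ℚ.↧ fromℤ j ℤ.+ ℚ.↥ fromℤ j ℤ.* ℚ.↧ fromℤ i ≡ i ℤ.+ j
  numerator = trans (cong₂ ℤ._+_ (cong₂ ℤ._*_ (↥-fromℤ i) (↧-fromℤ j)) (cong₂ ℤ._*_ (↥-fromℤ j) (↧-fromℤ i)))
                    (cong₂ ℤ._+_ (ℤ.*-identityʳ i) (ℤ.*-identityʳ j))
  denominator : ℚ.↧ₙ fromℤ i * ℚ.↧ₙ fromℤ j ≡ 1
  denominator = cong₂ _*_ (↧ₙ-fromℤ i) (↧ₙ-fromℤ j)

fromℤ-* : ∀ i j → fromℤ i ℚ.* fromℤ j ≡ fromℤ (i ℤ.* j)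
fromℤ-* i j = trans (unfold (fromℤ i) (fromℤ j)) (ℚ./-cong numerator denominator)
  where
  unfold : ∀ p q → p ℚ.* q ≡ (ℚ.↥ p ℤ.* ℚ.↥ q) ℚ./ (ℚ.↧ₙ p * ℚ.↧ₙ q)
  unfold (ℚ.mkℚ _ _ _) (ℚ.mkℚ _ _ _) = refl
  numerator : ℚ.↥ fromℤ i ℤ.* ℚ.↥ fromℤ j ≡ i ℤ.* j
  numerator = cong₂ ℤ._*_ (↥-fromℤ i) (↥-fromℤ j)
  denominator : ℚ.↧ₙ fromℤ i * ℚ.↧ₙ fromℤ j ≡ 1
  denominator = cong₂ _*_ (↧ₙ-fromℤ i) (↧ₙ-fromℤ j)

fromℤ-neg : ∀ i → ℚ.- fromℤ i ≡ fromℤ (ℤ.- i)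
fromℤ-neg i = trans (sym (ℚ.↥p/↧p≡p (ℚ.- fromℤ i))) (ℚ./-cong numerator denominator)
  where
  numerator : ℚ.↥ (ℚ.- fromℤ i) ≡ ℤ.- i
  numerator = trans (ℚ.↥-neg (fromℤ i)) (cong ℤ.-_ (↥-fromℤ i))
  denominator : ℚ.↧ₙ (ℚ.- fromℤ i) ≡ 1
  denominator = trans (cong ℤ.∣_∣ (ℚ.↧-neg (fromℤ i))) (↧ₙ-fromℤ i)

fromℤ-- : ∀ i j → fromℤ i ℚ.- fromℤ j ≡ fromℤ (i ℤ.- j)
fromℤ-- i j = trans (cong (fromℤ i ℚ.+_) (fromℤ-neg j)) (fromℤ-+ i (ℤ.- j))

fromℤ-sum : ∀ {A : Set} (f g : A → ℕ) (ys : List A) →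
  sumℚ (map (λ y → fromℤ (ℤ.+ f y ℤ.- ℤ.+ g y)) ys) ≡ fromℤ (ℤ.+ sum (map f ys) ℤ.- ℤ.+ sum (map g ys))
fromℤ-sum f g [] = refl
fromℤ-sum f g (y ∷ ys) = begin
  fromℤ (ℤ.+ f y ℤ.- ℤ.+ g y) ℚ.+ sumℚ (map (λ y → fromℤ (ℤ.+ f y ℤ.- ℤ.+ g y)) ys)
    ≡⟨ cong (fromℤ (ℤ.+ f y ℤ.- ℤ.+ g y) ℚ.+_) (fromℤ-sum f g ys) ⟩
  fromℤ (ℤ.+ f y ℤ.- ℤ.+ g y) ℚ.+ fromℤ (ℤ.+ F ℤ.- ℤ.+ G)
    ≡⟨ fromℤ-+ (ℤ.+ f y ℤ.- ℤ.+ g y) (ℤ.+ F ℤ.- ℤ.+ G) ⟩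
  fromℤ ((ℤ.+ f y ℤ.- ℤ.+ g y) ℤ.+ (ℤ.+ F ℤ.- ℤ.+ G))
    ≡⟨ cong fromℤ (regroup (ℤ.+ f y) (ℤ.+ g y) (ℤ.+ F) (ℤ.+ G)) ⟩
  fromℤ ((ℤ.+ f y ℤ.+ ℤ.+ F) ℤ.- (ℤ.+ g y ℤ.+ ℤ.+ G))
    ≡⟨ cong fromℤ (sym (cong₂ ℤ._-_ (ℤ.pos-+ (f y) F) (ℤ.pos-+ (g y) G))) ⟩
  fromℤ (ℤ.+ (f y + F) ℤ.- ℤ.+ (g y + G)) ∎
  where
  open ≡-Reasoning
  F = sum (map f ys)
  G = sum (map g ys)
  regroup : ∀ a b c d → (a ℤ.- b) ℤ.+ (c ℤ.- d) ≡ (a ℤ.+ c) ℤ.- (b ℤ.+ d)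
  regroup = ℤ-Solver.solve-∀

-- Sums over all subsets

𝟙 : ∀ {p} {P : Set p} → Dec P → ℕ
𝟙 d = if does d then 1 else 0

δ : ℕ → ℕ → ℕ
δ a b = 𝟙 (a ℕ.≟ b)

module _ {a p} {A : Set a} {P : A → Set p} (P? : (x : A) → Dec (P x)) where

  sum-filter : ∀ (g : A → ℕ) xs → sum (map g (filter P? xs)) ≡ sum (map (λ x → 𝟙 (P? x) * g x) xs)
  sum-filter g [] = refl
  sum-filter g (x ∷ xs) with does (P? x)
  ... | true  = cong₂ _+_ (sym (ℕ.*-identityˡ (g x))) (sum-filter g xs)
  ... | false = sum-filter g xs

  length-filter≤sum : ∀ (g : A → ℕ) xs → (∀ x → P x → 1 ≤ g x) → length (filter P? xs) ≤ sum (map g xs)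
  length-filter≤sum g [] _ = z≤n
  length-filter≤sum g (x ∷ xs) g≥1 with P? x
  ... | yes px = ℕ.+-mono-≤ (g≥1 x px) (length-filter≤sum g xs g≥1)
  ... | no _   = ℕ.≤-trans (length-filter≤sum g xs g≥1) (ℕ.m≤n+m _ (g x))

sumSubsets : ∀ n → (Subset n → ℕ) → ℕ
sumSubsets zero f = f []
sumSubsets (suc n) f = sumSubsets n (λ y → f (true ∷ y)) + sumSubsets n (λ y → f (false ∷ y))

sum-allSubsets : ∀ n (f : Subset n → ℕ) → sum (map f (allSubsets n)) ≡ sumSubsets n f
sum-allSubsets zero f = ℕ.+-identityʳ (f [])
sum-allSubsets (suc n) f = begin
  sum (map f (map (true ∷_) ys ++ map (false ∷_) ys))
    ≡⟨ cong sum (map-++ f (map (true ∷_) ys) (map (false ∷_) ys)) ⟩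
  sum (map f (map (true ∷_) ys) ++ map f (map (false ∷_) ys))
    ≡⟨ sum-++ (map f (map (true ∷_) ys)) _ ⟩
  sum (map f (map (true ∷_) ys)) + sum (map f (map (false ∷_) ys))
    ≡⟨ cong₂ _+_ (cong sum (sym (map-∘ ys))) (cong sum (sym (map-∘ ys))) ⟩
  sum (map (λ y → f (true ∷ y)) ys) + sum (map (λ y → f (false ∷ y)) ys)
    ≡⟨ cong₂ _+_ (sum-allSubsets n _) (sum-allSubsets n _) ⟩
  sumSubsets (suc n) f ∎
  where open ≡-Reasoning
        ys = allSubsets n

sumSubsets-cong : ∀ n {f g : Subset n → ℕ} → (∀ y → f y ≡ g y) → sumSubsets n f ≡ sumSubsets n g
sumSubsets-cong zero f≗g = f≗g []
sumSubsets-cong (suc n) f≗g =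
  cong₂ _+_ (sumSubsets-cong n (λ y → f≗g (true ∷ y))) (sumSubsets-cong n (λ y → f≗g (false ∷ y)))

sumSubsets-zero : ∀ n → sumSubsets n (λ _ → 0) ≡ 0
sumSubsets-zero zero = refl
sumSubsets-zero (suc n) = cong₂ _+_ (sumSubsets-zero n) (sumSubsets-zero n)

sumSubsets-+ : ∀ n (f g : Subset n → ℕ) → sumSubsets n (λ y → f y + g y) ≡ sumSubsets n f + sumSubsets n g
sumSubsets-+ zero f g = refl
sumSubsets-+ (suc n) f g = trans
  (cong₂ _+_ (sumSubsets-+ n (λ y → f (true ∷ y)) (λ y → g (true ∷ y)))
             (sumSubsets-+ n (λ y → f (false ∷ y)) (λ y → g (false ∷ y))))
  (interchange (sumSubsets n (λ y → f (true ∷ y))) (sumSubsets n (λ y → g (true ∷ y)))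
               (sumSubsets n (λ y → f (false ∷ y))) (sumSubsets n (λ y → g (false ∷ y))))
  where
  interchange : ∀ a b c d → (a + b) + (c + d) ≡ (a + c) + (b + d)
  interchange = solve-∀

sumSubsets-*suc : ∀ n (f g : Subset n → ℕ) →
  sumSubsets n (λ y → f y * suc (g y)) ≡ sumSubsets n f + sumSubsets n (λ y → f y * g y)
sumSubsets-*suc n f g = trans (sumSubsets-cong n (λ y → ℕ.*-suc (f y) (g y))) (sumSubsets-+ n f (λ y → f y * g y))

sumSubsets-*ʳ : ∀ n (f : Subset n → ℕ) c → sumSubsets n (λ y → f y * c) ≡ sumSubsets n f * c
sumSubsets-*ʳ zero f c = refl
sumSubsets-*ʳ (suc n) f c = trans
  (cong₂ _+_ (sumSubsets-*ʳ n (λ y → f (true ∷ y)) c) (sumSubsets-*ʳ n (λ y → f (false ∷ y)) c))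
  (sym (ℕ.*-distribʳ-+ c (sumSubsets n (λ y → f (true ∷ y))) _))

sumSubsets-size : ∀ n s → sumSubsets n (λ y → δ (∣ y ∣) s) ≡ n C s
sumSubsets-size zero zero = refl
sumSubsets-size zero (suc s) = sym (k>n⇒nCk≡0 (ℕ.0<1+n {s}))
sumSubsets-size (suc n) zero = cong₂ _+_ (sumSubsets-zero n) (sumSubsets-size n zero)
sumSubsets-size (suc n) (suc s) =
  trans (cong₂ _+_ (sumSubsets-size n s) (sumSubsets-size n (suc s))) (nCk+nC[k+1]≡[n+1]C[k+1] n s)

∣q∣≡∣p∩q∣+∣q─p∣ : ∀ {n} (p q : Subset n) → ∣ q ∣ ≡ ∣ p ∩ q ∣ + ∣ q ─ p ∣
∣q∣≡∣p∩q∣+∣q─p∣ [] [] = refl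
∣q∣≡∣p∩q∣+∣q─p∣ (true ∷ p) (true ∷ q) = cong suc (∣q∣≡∣p∩q∣+∣q─p∣ p q)
∣q∣≡∣p∩q∣+∣q─p∣ (true ∷ p) (false ∷ q) = ∣q∣≡∣p∩q∣+∣q─p∣ p q
∣q∣≡∣p∩q∣+∣q─p∣ (false ∷ p) (true ∷ q) =
  trans (cong suc (∣q∣≡∣p∩q∣+∣q─p∣ p q)) (sym (ℕ.+-suc ∣ p ∩ q ∣ ∣ q ─ p ∣))
∣q∣≡∣p∩q∣+∣q─p∣ (false ∷ p) (false ∷ q) = ∣q∣≡∣p∩q∣+∣q─p∣ p q

∣p∣+∣∁p∣≡n : ∀ {n} (p : Subset n) {s} → ∣ p ∣ ≡ s → s + ∣ ∁ p ∣ ≡ n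
∣p∣+∣∁p∣≡n p {s} refl =
  trans (ℕ.+-comm s ∣ ∁ p ∣) (trans (cong (_+ s) (∣∁p∣≡n∸∣p∣ p)) (ℕ.m∸n+n≡m (∣p∣≤n p)))

-- Counting subsets by deletions from and insertions into x

-- Recursive rather than the product of shape≡δ*δ, so that it computes to 0 as soon as the
-- leading coordinates already delete more than M or insert more than U points.
shape : ∀ {n} → Subset n → Subset n → ℕ → ℕ → ℕ
shape (true ∷ x) (true ∷ y) M U = shape x y M U
shape (true ∷ x) (false ∷ y) zero U = 0
shape (true ∷ x) (false ∷ y) (suc M) U = shape x y M U
shape (false ∷ x) (true ∷ y) M zero = 0
shape (false ∷ x) (true ∷ y) M (suc U) = shape x y M U
shape (false ∷ x) (false ∷ y) M U = shape x y M U
shape [] [] zero zero = 1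
shape [] [] _ _ = 0

shape≡δ*δ : ∀ {n} (x y : Subset n) M U → shape x y M U ≡ δ (∣ x ─ y ∣) M * δ (∣ y ─ x ∣) U
shape≡δ*δ [] [] zero zero = refl
shape≡δ*δ [] [] zero (suc U) = refl
shape≡δ*δ [] [] (suc M) U = refl
shape≡δ*δ (true ∷ x) (true ∷ y) M U = shape≡δ*δ x y M U
shape≡δ*δ (false ∷ x) (false ∷ y) M U = shape≡δ*δ x y M U
shape≡δ*δ (true ∷ x) (false ∷ y) zero U = refl
shape≡δ*δ (true ∷ x) (false ∷ y) (suc M) U = shape≡δ*δ x y M U
shape≡δ*δ (false ∷ x) (true ∷ y) M zero = sym (ℕ.*-zeroʳ (δ (∣ x ─ y ∣) M))
shape≡δ*δ (false ∷ x) (true ∷ y) M (suc U) = shape≡δ*δ x y M U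

shapeSum : ∀ {n} → Subset n → ℕ → ℕ → (Subset n → ℕ) → ℕ
shapeSum {n} x M U h = sumSubsets n (λ y → shape x y M U * h y)

sumSubsets-shape : ∀ {n} (x : Subset n) M U → sumSubsets n (λ y → shape x y M U) ≡ (∣ x ∣ C M) * (∣ ∁ x ∣ C U)
sumSubsets-shape [] zero zero = refl
sumSubsets-shape [] zero (suc U) = sym (trans (ℕ.*-identityˡ (0 C suc U)) (k>n⇒nCk≡0 (ℕ.0<1+n {U})))
sumSubsets-shape [] (suc M) U = sym (cong (_* (0 C U)) (k>n⇒nCk≡0 (ℕ.0<1+n {M})))
sumSubsets-shape {suc n} (true ∷ x) zero U =
  trans (cong₂ _+_ (sumSubsets-shape x zero U) (sumSubsets-zero n)) (ℕ.+-identityʳ ((∣ x ∣ C 0) * (∣ ∁ x ∣ C U)))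
sumSubsets-shape {suc n} (true ∷ x) (suc M) U = begin
  sumSubsets n (λ y → shape x y (suc M) U) + sumSubsets n (λ y → shape x y M U)
    ≡⟨ cong₂ _+_ (sumSubsets-shape x (suc M) U) (sumSubsets-shape x M U) ⟩
  (∣ x ∣ C suc M) * c + (∣ x ∣ C M) * c
    ≡⟨ ℕ.+-comm ((∣ x ∣ C suc M) * c) _ ⟩
  (∣ x ∣ C M) * c + (∣ x ∣ C suc M) * c
    ≡⟨ ℕ.*-distribʳ-+ c (∣ x ∣ C M) _ ⟨
  (∣ x ∣ C M + ∣ x ∣ C suc M) * c
    ≡⟨ cong (_* c) (nCk+nC[k+1]≡[n+1]C[k+1] ∣ x ∣ M) ⟩
  (suc ∣ x ∣ C suc M) * c ∎
  where open ≡-Reasoning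
        c = ∣ ∁ x ∣ C U
sumSubsets-shape {suc n} (false ∷ x) M zero = cong₂ _+_ (sumSubsets-zero n) (sumSubsets-shape x M zero)
sumSubsets-shape {suc n} (false ∷ x) M (suc U) = begin
  sumSubsets n (λ y → shape x y M U) + sumSubsets n (λ y → shape x y M (suc U))
    ≡⟨ cong₂ _+_ (sumSubsets-shape x M U) (sumSubsets-shape x M (suc U)) ⟩
  b * (∣ ∁ x ∣ C U) + b * (∣ ∁ x ∣ C suc U)
    ≡⟨ ℕ.*-distribˡ-+ b (∣ ∁ x ∣ C U) _ ⟨
  b * (∣ ∁ x ∣ C U + ∣ ∁ x ∣ C suc U)
    ≡⟨ cong (b *_) (nCk+nC[k+1]≡[n+1]C[k+1] ∣ ∁ x ∣ U) ⟩
  b * (suc ∣ ∁ x ∣ C suc U) ∎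
  where open ≡-Reasoning
        b = ∣ x ∣ C M

count₁₀ : ∀ {n} (x : Subset n) → (∣ x ∣ C 1) * (∣ ∁ x ∣ C 0) ≡ ∣ x ∣
count₁₀ x = trans (ℕ.*-identityʳ (∣ x ∣ C 1)) (nC1≡n ∣ x ∣)

count₀₁ : ∀ {n} (x : Subset n) → (∣ x ∣ C 0) * (∣ ∁ x ∣ C 1) ≡ ∣ ∁ x ∣
count₀₁ x = trans (ℕ.*-identityˡ (∣ ∁ x ∣ C 1)) (nC1≡n ∣ ∁ x ∣)

count₁₁ : ∀ {n} (x : Subset n) → (∣ x ∣ C 1) * (∣ ∁ x ∣ C 1) ≡ ∣ x ∣ * ∣ ∁ x ∣
count₁₁ x = cong₂ _*_ (nC1≡n ∣ x ∣) (nC1≡n ∣ ∁ x ∣)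

shapeSum₀₀ : ∀ {n} (x : Subset n) (h : Subset n → ℕ) → shapeSum x 0 0 h ≡ h x
shapeSum₀₀ [] h = ℕ.+-identityʳ (h [])
shapeSum₀₀ {suc n} (true ∷ x) h =
  trans (cong₂ _+_ (shapeSum₀₀ x (λ y → h (true ∷ y))) (sumSubsets-zero n)) (ℕ.+-identityʳ (h (true ∷ x)))
shapeSum₀₀ {suc n} (false ∷ x) h = cong₂ _+_ (sumSubsets-zero n) (shapeSum₀₀ x (λ y → h (false ∷ y)))

shapeSum-suc : ∀ {n} (x : Subset n) M U (f : Subset n → ℕ) →
  shapeSum x M U (λ y → suc (f y)) ≡ (∣ x ∣ C M) * (∣ ∁ x ∣ C U) + shapeSum x M U f
shapeSum-suc {n} x M U f =
  trans (sumSubsets-*suc n (λ y → shape x y M U) f) (cong (_+ shapeSum x M U f) (sumSubsets-shape x M U))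

shapeSum-affine : ∀ {n} (x : Subset n) M U a (h : Subset n → ℕ) c →
  shapeSum x M U (λ y → a + h y * c) ≡ (∣ x ∣ C M) * (∣ ∁ x ∣ C U) * a + shapeSum x M U h * c
shapeSum-affine {n} x M U a h c = begin
  sumSubsets n (λ y → shape x y M U * (a + h y * c))
    ≡⟨ sumSubsets-cong n (λ y → distrib (shape x y M U) a (h y) c) ⟩
  sumSubsets n (λ y → shape x y M U * a + shape x y M U * h y * c)
    ≡⟨ sumSubsets-+ n (λ y → shape x y M U * a) (λ y → shape x y M U * h y * c) ⟩
  sumSubsets n (λ y → shape x y M U * a) + sumSubsets n (λ y → shape x y M U * h y * c)
    ≡⟨ cong₂ _+_ (sumSubsets-*ʳ n (λ y → shape x y M U) a) (sumSubsets-*ʳ n (λ y → shape x y M U * h y) c) ⟩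
  sumSubsets n (λ y → shape x y M U) * a + shapeSum x M U h * c
    ≡⟨ cong (λ m → m * a + shapeSum x M U h * c) (sumSubsets-shape x M U) ⟩
  (∣ x ∣ C M) * (∣ ∁ x ∣ C U) * a + shapeSum x M U h * c ∎
  where
  open ≡-Reasoning
  distrib : ∀ s a h c → s * (a + h * c) ≡ s * a + s * h * c
  distrib = solve-∀

-- Neighbourhoods in J(n,3)

neighbours : ∀ {n} → Subset n → List (Subset n)
neighbours {n} x = filter (λ y → ∣ x ∩ y ∣ ℕ.≟ 2) (J3vertices n)

adjacency≡shape₁₁ : ∀ a m u → a + m ≡ 3 → δ (a + u) 3 * δ a 2 ≡ δ m 1 * δ u 1
adjacency≡shape₁₁ 0 .3 u refl = ℕ.*-zeroʳ (δ u 3)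
adjacency≡shape₁₁ 1 .2 u refl = ℕ.*-zeroʳ (δ (1 + u) 3)
adjacency≡shape₁₁ 2 .1 u refl = ℕ.*-comm (δ u 1) 1
adjacency≡shape₁₁ 3 .0 u refl = ℕ.*-zeroʳ (δ (3 + u) 3)

sum-neighbours : ∀ {n} (x : Subset n) → ∣ x ∣ ≡ 3 → (h : Subset n → ℕ) →
  sum (map h (neighbours x)) ≡ shapeSum x 1 1 h
sum-neighbours {n} x ∣x∣≡3 h = begin
  sum (map h (neighbours x))
    ≡⟨ sum-filter (λ y → ∣ x ∩ y ∣ ℕ.≟ 2) h (J3vertices n) ⟩
  sum (map (λ y → δ (∣ x ∩ y ∣) 2 * h y) (J3vertices n))
    ≡⟨ sum-filter (λ y → ∣ y ∣ ℕ.≟ 3) _ (allSubsets n) ⟩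
  sum (map (λ y → δ (∣ y ∣) 3 * (δ (∣ x ∩ y ∣) 2 * h y)) (allSubsets n))
    ≡⟨ sum-allSubsets n _ ⟩
  sumSubsets n (λ y → δ (∣ y ∣) 3 * (δ (∣ x ∩ y ∣) 2 * h y))
    ≡⟨ sumSubsets-cong n (λ y → trans (sym (ℕ.*-assoc (δ (∣ y ∣) 3) _ (h y))) (cong (_* h y) (pointwise y))) ⟩
  shapeSum x 1 1 h ∎
  where
  open ≡-Reasoning
  pointwise : ∀ y → δ (∣ y ∣) 3 * δ (∣ x ∩ y ∣) 2 ≡ shape x y 1 1
  pointwise y = trans (cong (λ s → δ s 3 * δ (∣ x ∩ y ∣) 2) (∣q∣≡∣p∩q∣+∣q─p∣ x y))
    (trans (adjacency≡shape₁₁ (∣ x ∩ y ∣) (∣ x ─ y ∣) (∣ y ─ x ∣)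
      (trans (cong (λ s → ∣ s ∣ + ∣ x ─ y ∣) (∩-comm x y)) (trans (sym (∣q∣≡∣p∩q∣+∣q─p∣ y x)) ∣x∣≡3)))
      (sym (shape≡δ*δ x y 1 1)))

∈J3vertices⇒∣x∣≡3 : ∀ {n} {x : Subset n} → x ∈ J3vertices n → ∣ x ∣ ≡ 3
∈J3vertices⇒∣x∣≡3 {n} x∈ = proj₂ (∈-filter⁻ (λ s → ∣ s ∣ ℕ.≟ 3) {xs = allSubsets n} x∈)

numNeg≤sum : ∀ n (v : Subset n → ℚ) (m : Subset n → ℕ) → (∀ y → v y ℚ.< 0ℚ → 1 ≤ m y) →
  numNeg n v ≤ sumSubsets n (λ y → δ (∣ y ∣) 3 * m y)
numNeg≤sum n v m neg⇒m≥1 = ℕ.≤-trans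
  (length-filter≤sum (λ y → v y ℚ.<? 0ℚ) m (J3vertices n) neg⇒m≥1)
  (ℕ.≤-reflexive (trans (sum-filter (λ s → ∣ s ∣ ℕ.≟ 3) m (allSubsets n)) (sum-allSubsets n _)))

threeMinus : ∀ {n} → (Subset n → ℕ) → Subset n → ℚ
threeMinus g y = fromℤ (ℤ.+ 3 ℤ.- ℤ.+ g y)

ℕ-eigen⇒ℤ-eigen : ∀ n A B X → A + (n * X + 7 * 3) ≡ n * 3 + 7 * X + B →
  ℤ.+ A ℤ.- ℤ.+ B ≡ (ℤ.+ n ℤ.- ℤ.+ 7) ℤ.* (ℤ.+ 3 ℤ.- ℤ.+ X)
ℕ-eigen⇒ℤ-eigen n A B X eq = begin
  a ℤ.- b
    ≡⟨ regroup a b (ℤ.+ n) x ⟩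
  (a ℤ.+ (ℤ.+ n ℤ.* x ℤ.+ ℤ.+ 21)) ℤ.- (ℤ.+ n ℤ.* x ℤ.+ ℤ.+ 21) ℤ.- b
    ≡⟨ cong (λ z → z ℤ.- (ℤ.+ n ℤ.* x ℤ.+ ℤ.+ 21) ℤ.- b) eqℤ ⟩
  (ℤ.+ n ℤ.* ℤ.+ 3 ℤ.+ ℤ.+ 7 ℤ.* x ℤ.+ b) ℤ.- (ℤ.+ n ℤ.* x ℤ.+ ℤ.+ 21) ℤ.- b
    ≡⟨ factor (ℤ.+ n) x b ⟩
  (ℤ.+ n ℤ.- ℤ.+ 7) ℤ.* (ℤ.+ 3 ℤ.- x) ∎
  where
  open ≡-Reasoning
  a = ℤ.+ A
  b = ℤ.+ B
  x = ℤ.+ X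
  eqℤ : a ℤ.+ (ℤ.+ n ℤ.* x ℤ.+ ℤ.+ 21) ≡ ℤ.+ n ℤ.* ℤ.+ 3 ℤ.+ ℤ.+ 7 ℤ.* x ℤ.+ b
  eqℤ = begin
    a ℤ.+ (ℤ.+ n ℤ.* x ℤ.+ ℤ.+ 21)       ≡⟨ cong (λ z → a ℤ.+ (z ℤ.+ ℤ.+ 21)) (ℤ.pos-* n X) ⟨
    a ℤ.+ ℤ.+ (n * X + 21)               ≡⟨ ℤ.pos-+ A (n * X + 21) ⟨
    ℤ.+ (A + (n * X + 7 * 3))            ≡⟨ cong ℤ.+_ eq ⟩
    ℤ.+ (n * 3 + 7 * X + B)              ≡⟨ ℤ.pos-+ (n * 3 + 7 * X) B ⟩
    ℤ.+ (n * 3 + 7 * X) ℤ.+ b            ≡⟨ cong (ℤ._+ b) (ℤ.pos-+ (n * 3) (7 * X)) ⟩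
    ℤ.+ (n * 3) ℤ.+ ℤ.+ (7 * X) ℤ.+ b    ≡⟨ cong₂ (λ u v → u ℤ.+ v ℤ.+ b) (ℤ.pos-* n 3) (ℤ.pos-* 7 X) ⟩
    ℤ.+ n ℤ.* ℤ.+ 3 ℤ.+ ℤ.+ 7 ℤ.* x ℤ.+ b ∎
  regroup : ∀ a b n x → a ℤ.- b ≡ (a ℤ.+ (n ℤ.* x ℤ.+ ℤ.+ 21)) ℤ.- (n ℤ.* x ℤ.+ ℤ.+ 21) ℤ.- b
  regroup = ℤ-Solver.solve-∀
  factor : ∀ n x b → (n ℤ.* ℤ.+ 3 ℤ.+ ℤ.+ 7 ℤ.* x ℤ.+ b) ℤ.- (n ℤ.* x ℤ.+ ℤ.+ 21) ℤ.- b ≡ (n ℤ.- ℤ.+ 7) ℤ.* (ℤ.+ 3 ℤ.- x)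
  factor = ℤ-Solver.solve-∀

eigen-arith : ∀ n o X B → 3 + o ≡ n → B + 7 * X ≡ n * X + 6 * (n ∸ 1) →
  3 * o * 3 + (n * X + 7 * 3) ≡ n * 3 + 7 * X + B
eigen-arith .(3 + o) o X B refl eq = begin
  3 * o * 3 + ((3 + o) * X + 7 * 3)     ≡⟨ regroup o X ⟩
  (3 + o) * 3 + ((3 + o) * X + 6 * (2 + o)) ≡⟨ cong ((3 + o) * 3 +_) eq ⟨
  (3 + o) * 3 + (B + 7 * X)             ≡⟨ swap ((3 + o) * 3) B (7 * X) ⟩
  (3 + o) * 3 + 7 * X + B ∎
  where
  open ≡-Reasoning
  regroup : ∀ o X → 3 * o * 3 + ((3 + o) * X + 7 * 3) ≡ (3 + o) * 3 + ((3 + o) * X + 6 * (2 + o))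
  regroup = solve-∀
  swap : ∀ a b c → a + (b + c) ≡ a + c + b
  swap = solve-∀

-- A triple has 3(n−3) neighbours, so (A(3 − g))(x) = (n−7)(3 − g x) amounts to
-- Σ_{y∼x} g y = (n−7)·g x + 6(n−1).
eigen-at : ∀ {n} (x : Subset n) → ∣ x ∣ ≡ 3 → (g : Subset n → ℕ) →
  shapeSum x 1 1 g + 7 * g x ≡ n * g x + 6 * (n ∸ 1) →
  adjApply n (threeMinus g) x ≡ lambda2 n ℚ.* threeMinus g x
eigen-at {n} x ∣x∣≡3 g eq = begin
  sumℚ (map (threeMinus g) (neighbours x))
    ≡⟨ fromℤ-sum (λ _ → 3) g (neighbours x) ⟩
  fromℤ (ℤ.+ sum (map (λ _ → 3) (neighbours x)) ℤ.- ℤ.+ sum (map g (neighbours x)))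
    ≡⟨ cong fromℤ (ℕ-eigen⇒ℤ-eigen n _ _ (g x) (subst₂ (λ A B → A + (n * g x + 7 * 3) ≡ n * 3 + 7 * g x + B)
                      (sym Σ3) (sym (sum-neighbours x ∣x∣≡3 g)) (eigen-arith n ∣ ∁ x ∣ (g x) _ (∣p∣+∣∁p∣≡n x ∣x∣≡3) eq))) ⟩
  fromℤ ((ℤ.+ n ℤ.- ℤ.+ 7) ℤ.* (ℤ.+ 3 ℤ.- ℤ.+ g x))
    ≡⟨ fromℤ-* (ℤ.+ n ℤ.- ℤ.+ 7) _ ⟨
  fromℤ (ℤ.+ n ℤ.- ℤ.+ 7) ℚ.* threeMinus g x
    ≡⟨ cong (ℚ._* threeMinus g x) (fromℤ-- (ℤ.+ n) (ℤ.+ 7)) ⟨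
  lambda2 n ℚ.* threeMinus g x ∎
  where
  open ≡-Reasoning
  Σ3 : sum (map (λ _ → 3) (neighbours x)) ≡ 3 * ∣ ∁ x ∣ * 3
  Σ3 = trans (sum-neighbours x ∣x∣≡3 (λ _ → 3))
      (trans (sumSubsets-*ʳ n (λ y → shape x y 1 1) 3)
             (cong (_* 3) (trans (sumSubsets-shape x 1 1) (trans (count₁₁ x) (cong (_* ∣ ∁ x ∣) ∣x∣≡3)))))

threeMinus-nonzero : ∀ a b c → a < 3 → 3 < c → fromℤ (ℤ.+ 3 ℤ.- ℤ.+ (a + b * c)) ≢ 0ℚ
threeMinus-nonzero a b c a<3 3<c v≡0 = ≢3 b (ℤ.+-injective (ℤ.i-j≡0⇒i≡j (ℤ.+ 3) _ (fromℤ-injective v≡0)))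
  where
  ≢3 : ∀ b → 3 ≢ a + b * c
  ≢3 zero 3≡a = ℕ.<-irrefl (sym (trans 3≡a (ℕ.+-identityʳ a))) a<3
  ≢3 (suc b) 3≡ = ℕ.<-irrefl 3≡ (ℕ.<-≤-trans 3<c (ℕ.≤-trans (ℕ.m≤m+n c (b * c)) (ℕ.m≤n+m (suc b * c) a)))

threeMinus-negative⇒1≤b : ∀ a b c → a < 3 → fromℤ (ℤ.+ 3 ℤ.- ℤ.+ (a + b * c)) ℚ.< 0ℚ → 1 ≤ b
threeMinus-negative⇒1≤b a (suc b) c _ _ = s≤s z≤n
threeMinus-negative⇒1≤b 0 zero c _ v<0 = ⊥-elim (ℚ.<-asym v<0 (toWitness {a? = 0ℚ ℚ.<? fromℤ (ℤ.+ 3)} _))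
threeMinus-negative⇒1≤b 1 zero c _ v<0 = ⊥-elim (ℚ.<-asym v<0 (toWitness {a? = 0ℚ ℚ.<? fromℤ (ℤ.+ 2)} _))
threeMinus-negative⇒1≤b 2 zero c _ v<0 = ⊥-elim (ℚ.<-asym v<0 (toWitness {a? = 0ℚ ℚ.<? fromℤ (ℤ.+ 1)} _))
threeMinus-negative⇒1≤b (suc (suc (suc a))) zero c (s≤s (s≤s (s≤s ()))) _

-- The perfect matching of Fin (2k)

double : ℕ → ℕ
double zero = zero
double (suc k) = suc (suc (double k))

double≡2* : ∀ k → double k ≡ 2 * k
double≡2* zero = refl
double≡2* (suc k) = trans (cong (λ m → 2 + m) (double≡2* k)) (sym (ℕ.*-distribˡ-+ 2 1 k))

parity : ∀ m → (Σ ℕ λ j → m ≡ double j) ⊎ (Σ ℕ λ j → m ≡ suc (double j))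
parity zero = inj₁ (0 , refl)
parity (suc zero) = inj₂ (0 , refl)
parity (suc (suc m)) with parity m
... | inj₁ (j , refl) = inj₁ (suc j , refl)
... | inj₂ (j , refl) = inj₂ (suc j , refl)

blocks : ∀ {k} → ℕ → Subset (double k) → ℕ
blocks {zero} i [] = 0
blocks {suc k} i (a ∷ b ∷ x) = δ (∣ a ∷ b ∷ [] ∣) i + blocks i x

choose₂ : ℕ → ℕ
choose₂ zero = zero
choose₂ (suc m) = m + choose₂ m

∣x∣≡2*blocks₂+blocks₁ : ∀ {k} (x : Subset (double k)) → ∣ x ∣ ≡ 2 * blocks 2 x + blocks 1 x
∣x∣≡2*blocks₂+blocks₁ {zero} [] = refl
∣x∣≡2*blocks₂+blocks₁ {suc k} (true ∷ true ∷ x) =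
  trans (cong (λ s → 2 + s) (∣x∣≡2*blocks₂+blocks₁ x)) (arith (blocks 2 x) (blocks 1 x))
  where arith : ∀ q r → 2 + (2 * q + r) ≡ 2 * (1 + q) + r
        arith = solve-∀
∣x∣≡2*blocks₂+blocks₁ {suc k} (true ∷ false ∷ x) =
  trans (cong suc (∣x∣≡2*blocks₂+blocks₁ x)) (sym (ℕ.+-suc (2 * blocks 2 x) (blocks 1 x)))
∣x∣≡2*blocks₂+blocks₁ {suc k} (false ∷ true ∷ x) =
  trans (cong suc (∣x∣≡2*blocks₂+blocks₁ x)) (sym (ℕ.+-suc (2 * blocks 2 x) (blocks 1 x)))
∣x∣≡2*blocks₂+blocks₁ {suc k} (false ∷ false ∷ x) = ∣x∣≡2*blocks₂+blocks₁ x

sumSubsets-by-block : ∀ {k} (f : Subset (double (suc k)) → ℕ) {a b c d} →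
  sumSubsets (double k) (λ y → f (true ∷ true ∷ y)) ≡ a → sumSubsets (double k) (λ y → f (true ∷ false ∷ y)) ≡ b →
  sumSubsets (double k) (λ y → f (false ∷ true ∷ y)) ≡ c → sumSubsets (double k) (λ y → f (false ∷ false ∷ y)) ≡ d →
  sumSubsets (double (suc k)) f ≡ (a + b) + (c + d)
sumSubsets-by-block f refl refl refl refl = refl

shapeSum-by-block : ∀ {k} (x : Subset (double (suc k))) M U h {a b c d} →
  let summand y = shape x y M U * h y in
  sumSubsets (double k) (λ y → summand (true ∷ true ∷ y)) ≡ a → sumSubsets (double k) (λ y → summand (true ∷ false ∷ y)) ≡ b →
  sumSubsets (double k) (λ y → summand (false ∷ true ∷ y)) ≡ c → sumSubsets (double k) (λ y → summand (false ∷ false ∷ y)) ≡ d →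
  shapeSum x M U h ≡ (a + b) + (c + d)
shapeSum-by-block x M U h = sumSubsets-by-block (λ y → shape x y M U * h y)

shapeSum₁₀-blocks₂ : ∀ {k} (x : Subset (double k)) →
  shapeSum x 1 0 (blocks 2) ≡ blocks 2 x * blocks 1 x + 4 * choose₂ (blocks 2 x)
shapeSum₁₀-blocks₂ {zero} [] = refl
shapeSum₁₀-blocks₂ {suc k} (true ∷ true ∷ x) = trans
  (shapeSum-by-block (true ∷ true ∷ x) 1 0 (blocks 2)
    (trans (shapeSum-suc x 1 0 (blocks 2))
           (cong₂ _+_ (trans (count₁₀ x) (∣x∣≡2*blocks₂+blocks₁ x)) (shapeSum₁₀-blocks₂ x)))
    (shapeSum₀₀ x (blocks 2)) (shapeSum₀₀ x (blocks 2)) (sumSubsets-zero (double k)))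
  (arith (blocks 2 x) (blocks 1 x) (choose₂ (blocks 2 x)))
  where arith : ∀ q r t → ((2 * q + r) + (q * r + 4 * t)) + q + (q + 0) ≡ suc q * r + 4 * (q + t)
        arith = solve-∀
shapeSum₁₀-blocks₂ {suc k} (true ∷ false ∷ x) = trans
  (shapeSum-by-block (true ∷ false ∷ x) 1 0 (blocks 2)
    (sumSubsets-zero (double k)) (shapeSum₁₀-blocks₂ x) (sumSubsets-zero (double k)) (shapeSum₀₀ x (blocks 2)))
  (arith (blocks 2 x) (blocks 1 x) (choose₂ (blocks 2 x)))
  where arith : ∀ q r t → 0 + (q * r + 4 * t) + (0 + q) ≡ q * suc r + 4 * t
        arith = solve-∀
shapeSum₁₀-blocks₂ {suc k} (false ∷ true ∷ x) = trans
  (shapeSum-by-block (false ∷ true ∷ x) 1 0 (blocks 2)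
    (sumSubsets-zero (double k)) (sumSubsets-zero (double k)) (shapeSum₁₀-blocks₂ x) (shapeSum₀₀ x (blocks 2)))
  (arith (blocks 2 x) (blocks 1 x) (choose₂ (blocks 2 x)))
  where arith : ∀ q r t → 0 + 0 + (q * r + 4 * t + q) ≡ q * suc r + 4 * t
        arith = solve-∀
shapeSum₁₀-blocks₂ {suc k} (false ∷ false ∷ x) = trans
  (shapeSum-by-block (false ∷ false ∷ x) 1 0 (blocks 2)
    (sumSubsets-zero (double k)) (sumSubsets-zero (double k)) (sumSubsets-zero (double k)) (shapeSum₁₀-blocks₂ x))
  (arith (blocks 2 x) (blocks 1 x) (choose₂ (blocks 2 x)))
  where arith : ∀ q r t → 0 + 0 + (0 + (q * r + 4 * t)) ≡ q * r + 4 * t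
        arith = solve-∀

shapeSum₀₁-blocks₂ : ∀ {k} (x : Subset (double k)) → shapeSum x 0 1 (blocks 2) ≡ blocks 2 x * ∣ ∁ x ∣ + blocks 1 x
shapeSum₀₁-blocks₂ {zero} [] = refl
shapeSum₀₁-blocks₂ {suc k} (true ∷ true ∷ x) = trans
  (shapeSum-by-block (true ∷ true ∷ x) 0 1 (blocks 2)
    (trans (shapeSum-suc x 0 1 (blocks 2)) (cong₂ _+_ (count₀₁ x) (shapeSum₀₁-blocks₂ x)))
    (sumSubsets-zero (double k)) (sumSubsets-zero (double k)) (sumSubsets-zero (double k)))
  (arith (blocks 2 x) (blocks 1 x) ∣ ∁ x ∣)
  where arith : ∀ q r o → o + (q * o + r) + 0 + (0 + 0) ≡ suc q * o + r
        arith = solve-∀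
shapeSum₀₁-blocks₂ {suc k} (true ∷ false ∷ x) = trans
  (shapeSum-by-block (true ∷ false ∷ x) 0 1 (blocks 2)
    (shapeSum₀₀ x (λ y → suc (blocks 2 y))) (shapeSum₀₁-blocks₂ x)
    (sumSubsets-zero (double k)) (sumSubsets-zero (double k)))
  (arith (blocks 2 x) (blocks 1 x) ∣ ∁ x ∣)
  where arith : ∀ q r o → suc q + (q * o + r) + (0 + 0) ≡ q * suc o + suc r
        arith = solve-∀
shapeSum₀₁-blocks₂ {suc k} (false ∷ true ∷ x) = trans
  (shapeSum-by-block (false ∷ true ∷ x) 0 1 (blocks 2)
    (shapeSum₀₀ x (λ y → suc (blocks 2 y))) (sumSubsets-zero (double k))
    (shapeSum₀₁-blocks₂ x) (sumSubsets-zero (double k)))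
  (arith (blocks 2 x) (blocks 1 x) ∣ ∁ x ∣)
  where arith : ∀ q r o → suc q + 0 + (q * o + r + 0) ≡ q * suc o + suc r
        arith = solve-∀
shapeSum₀₁-blocks₂ {suc k} (false ∷ false ∷ x) = trans
  (shapeSum-by-block (false ∷ false ∷ x) 0 1 (blocks 2)
    (sumSubsets-zero (double k)) (shapeSum₀₀ x (blocks 2)) (shapeSum₀₀ x (blocks 2)) (shapeSum₀₁-blocks₂ x))
  (arith (blocks 2 x) (blocks 1 x) ∣ ∁ x ∣)
  where arith : ∀ q r o → 0 + q + (q + (q * o + r)) ≡ q * suc (suc o) + r
        arith = solve-∀

-- With q = blocks 2 x and r = blocks 1 x: a pair inside x survives when one of the other
-- ∣x∣ − 2 points is deleted and any of the ∣∁ x∣ points is inserted, a pair meeting x once is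
-- completed by inserting its missing point after deleting one of the other ∣x∣ − 1 points;
-- so the sum is q(2q + r − 2)∣∁ x∣ + r(2q + r − 1).
shapeSum₁₁-blocks₂ : ∀ {k} (x : Subset (double k)) →
  shapeSum x 1 1 (blocks 2) ≡
    (blocks 2 x * blocks 1 x + 4 * choose₂ (blocks 2 x)) * ∣ ∁ x ∣ + 2 * blocks 2 x * blocks 1 x + 2 * choose₂ (blocks 1 x)
shapeSum₁₁-blocks₂ {zero} [] = refl
shapeSum₁₁-blocks₂ {suc k} (true ∷ true ∷ x) = trans
  (shapeSum-by-block (true ∷ true ∷ x) 1 1 (blocks 2)
    (trans (shapeSum-suc x 1 1 (blocks 2))
           (cong₂ _+_ (trans (count₁₁ x) (cong (_* ∣ ∁ x ∣) (∣x∣≡2*blocks₂+blocks₁ x))) (shapeSum₁₁-blocks₂ x)))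
    (shapeSum₀₁-blocks₂ x) (shapeSum₀₁-blocks₂ x) (sumSubsets-zero (double k)))
  (arith (blocks 2 x) (blocks 1 x) ∣ ∁ x ∣ (choose₂ (blocks 2 x)) (choose₂ (blocks 1 x)))
  where arith : ∀ q r o t s →
          (2 * q + r) * o + ((q * r + 4 * t) * o + 2 * q * r + 2 * s) + (q * o + r) + (q * o + r + 0)
          ≡ (suc q * r + 4 * (q + t)) * o + 2 * suc q * r + 2 * s
        arith = solve-∀
shapeSum₁₁-blocks₂ {suc k} (true ∷ false ∷ x) = trans
  (shapeSum-by-block (true ∷ false ∷ x) 1 1 (blocks 2)
    (trans (shapeSum-suc x 1 0 (blocks 2))
           (cong₂ _+_ (trans (count₁₀ x) (∣x∣≡2*blocks₂+blocks₁ x)) (shapeSum₁₀-blocks₂ x)))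
    (shapeSum₁₁-blocks₂ x) (shapeSum₀₀ x (blocks 2)) (shapeSum₀₁-blocks₂ x))
  (arith (blocks 2 x) (blocks 1 x) ∣ ∁ x ∣ (choose₂ (blocks 2 x)) (choose₂ (blocks 1 x)))
  where arith : ∀ q r o t s →
          (2 * q + r + (q * r + 4 * t)) + ((q * r + 4 * t) * o + 2 * q * r + 2 * s) + (q + (q * o + r))
          ≡ (q * suc r + 4 * t) * suc o + 2 * q * suc r + 2 * (r + s)
        arith = solve-∀
shapeSum₁₁-blocks₂ {suc k} (false ∷ true ∷ x) = trans
  (shapeSum-by-block (false ∷ true ∷ x) 1 1 (blocks 2)
    (trans (shapeSum-suc x 1 0 (blocks 2))
           (cong₂ _+_ (trans (count₁₀ x) (∣x∣≡2*blocks₂+blocks₁ x)) (shapeSum₁₀-blocks₂ x)))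
    (shapeSum₀₀ x (blocks 2)) (shapeSum₁₁-blocks₂ x) (shapeSum₀₁-blocks₂ x))
  (arith (blocks 2 x) (blocks 1 x) ∣ ∁ x ∣ (choose₂ (blocks 2 x)) (choose₂ (blocks 1 x)))
  where arith : ∀ q r o t s →
          (2 * q + r + (q * r + 4 * t)) + q + (((q * r + 4 * t) * o + 2 * q * r + 2 * s) + (q * o + r))
          ≡ (q * suc r + 4 * t) * suc o + 2 * q * suc r + 2 * (r + s)
        arith = solve-∀
shapeSum₁₁-blocks₂ {suc k} (false ∷ false ∷ x) = trans
  (shapeSum-by-block (false ∷ false ∷ x) 1 1 (blocks 2)
    (sumSubsets-zero (double k)) (shapeSum₁₀-blocks₂ x) (shapeSum₁₀-blocks₂ x) (shapeSum₁₁-blocks₂ x))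
  (arith (blocks 2 x) (blocks 1 x) ∣ ∁ x ∣ (choose₂ (blocks 2 x)) (choose₂ (blocks 1 x)))
  where arith : ∀ q r o t s →
          0 + (q * r + 4 * t) + ((q * r + 4 * t) + ((q * r + 4 * t) * o + 2 * q * r + 2 * s))
          ≡ (q * r + 4 * t) * suc (suc o) + 2 * q * r + 2 * s
        arith = solve-∀

four≤2*[2+q]+r : ∀ q r → 4 ≤ 2 * (2 + q) + r
four≤2*[2+q]+r q r = ℕ.≤-trans (ℕ.*-monoʳ-≤ 2 (ℕ.m≤m+n 2 q)) (ℕ.m≤m+n (2 * (2 + q)) r)

even-vertex-arith : ∀ q r o → 2 * q + r ≡ 3 →
  (q * r + 4 * choose₂ q) * o + 2 * q * r + 2 * choose₂ r + 7 * q ≡ (3 + o) * q + 6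
even-vertex-arith 0 .3 o refl = arith o
  where arith : ∀ o → (0 * 3 + 4 * 0) * o + 2 * 0 * 3 + 2 * 3 + 7 * 0 ≡ (3 + o) * 0 + 6
        arith = solve-∀
even-vertex-arith 1 .1 o refl = arith o
  where arith : ∀ o → (1 * 1 + 4 * 0) * o + 2 * 1 * 1 + 2 * 0 + 7 * 1 ≡ (3 + o) * 1 + 6
        arith = solve-∀
even-vertex-arith (suc (suc q)) r o eq = ⊥-elim (ℕ.<-irrefl refl (subst (4 ≤_) eq (four≤2*[2+q]+r q r)))

odd-vertex-arith : ∀ q r o → 2 * q + r ≡ 3 →
  (q * r + 4 * choose₂ q) + ((q * r + 4 * choose₂ q) * o + 2 * q * r + 2 * choose₂ r) + 7 * q ≡ (4 + o) * q + 6
odd-vertex-arith 0 .3 o refl = arith o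
  where arith : ∀ o → (0 * 3 + 4 * 0) + ((0 * 3 + 4 * 0) * o + 2 * 0 * 3 + 2 * 3) + 7 * 0 ≡ (4 + o) * 0 + 6
        arith = solve-∀
odd-vertex-arith 1 .1 o refl = arith o
  where arith : ∀ o → (1 * 1 + 4 * 0) + ((1 * 1 + 4 * 0) * o + 2 * 1 * 1 + 2 * 0) + 7 * 1 ≡ (4 + o) * 1 + 6
        arith = solve-∀
odd-vertex-arith (suc (suc q)) r o eq = ⊥-elim (ℕ.<-irrefl refl (subst (4 ≤_) eq (four≤2*[2+q]+r q r)))

apex-vertex-arith : ∀ q r o → 2 * q + r ≡ 2 →
  ((q * r + 4 * choose₂ q) * o + 2 * q * r + 2 * choose₂ r) + (q * o + r) + 7 * q ≡ (3 + o) * q + 4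
apex-vertex-arith 0 .2 o refl = arith o
  where arith : ∀ o → ((0 * 2 + 4 * 0) * o + 2 * 0 * 2 + 2 * 1) + (0 * o + 2) + 7 * 0 ≡ (3 + o) * 0 + 4
        arith = solve-∀
apex-vertex-arith 1 .0 o refl = arith o
  where arith : ∀ o → ((1 * 0 + 4 * 0) * o + 2 * 1 * 0 + 2 * 0) + (1 * o + 0) + 7 * 1 ≡ (3 + o) * 1 + 4
        arith = solve-∀
apex-vertex-arith (suc (suc q)) r o eq = ⊥-elim (ℕ.<-asym (s≤s (s≤s (s≤s z≤n))) (subst (4 ≤_) eq (four≤2*[2+q]+r q r)))

blocks-even-vertex : ∀ {k} (x : Subset (double k)) → ∣ x ∣ ≡ 3 →
  shapeSum x 1 1 (blocks 2) + 7 * blocks 2 x ≡ double k * blocks 2 x + 6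
blocks-even-vertex x ∣x∣≡3 = begin
  shapeSum x 1 1 (blocks 2) + 7 * blocks 2 x
    ≡⟨ cong (_+ 7 * blocks 2 x) (shapeSum₁₁-blocks₂ x) ⟩
  _ ≡⟨ even-vertex-arith (blocks 2 x) (blocks 1 x) ∣ ∁ x ∣ (trans (sym (∣x∣≡2*blocks₂+blocks₁ x)) ∣x∣≡3) ⟩
  (3 + ∣ ∁ x ∣) * blocks 2 x + 6
    ≡⟨ cong (λ n → n * blocks 2 x + 6) (∣p∣+∣∁p∣≡n x ∣x∣≡3) ⟩
  _ ∎
  where open ≡-Reasoning

blocks-odd-vertex : ∀ {k} (x : Subset (double k)) → ∣ x ∣ ≡ 3 →
  shapeSum x 1 0 (blocks 2) + shapeSum x 1 1 (blocks 2) + 7 * blocks 2 x ≡ suc (double k) * blocks 2 x + 6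
blocks-odd-vertex x ∣x∣≡3 = begin
  shapeSum x 1 0 (blocks 2) + shapeSum x 1 1 (blocks 2) + 7 * blocks 2 x
    ≡⟨ cong₂ (λ a b → a + b + 7 * blocks 2 x) (shapeSum₁₀-blocks₂ x) (shapeSum₁₁-blocks₂ x) ⟩
  _ ≡⟨ odd-vertex-arith (blocks 2 x) (blocks 1 x) ∣ ∁ x ∣ (trans (sym (∣x∣≡2*blocks₂+blocks₁ x)) ∣x∣≡3) ⟩
  (4 + ∣ ∁ x ∣) * blocks 2 x + 6
    ≡⟨ cong (λ n → suc n * blocks 2 x + 6) (∣p∣+∣∁p∣≡n x ∣x∣≡3) ⟩
  _ ∎
  where open ≡-Reasoning

blocks-apex-vertex : ∀ {k} (x : Subset (double k)) → ∣ x ∣ ≡ 2 →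
  shapeSum x 1 1 (blocks 2) + shapeSum x 0 1 (blocks 2) + 7 * blocks 2 x ≡ suc (double k) * blocks 2 x + 4
blocks-apex-vertex x ∣x∣≡2 = begin
  shapeSum x 1 1 (blocks 2) + shapeSum x 0 1 (blocks 2) + 7 * blocks 2 x
    ≡⟨ cong₂ (λ a b → a + b + 7 * blocks 2 x) (shapeSum₁₁-blocks₂ x) (shapeSum₀₁-blocks₂ x) ⟩
  _ ≡⟨ apex-vertex-arith (blocks 2 x) (blocks 1 x) ∣ ∁ x ∣ (trans (sym (∣x∣≡2*blocks₂+blocks₁ x)) ∣x∣≡2) ⟩
  (3 + ∣ ∁ x ∣) * blocks 2 x + 4
    ≡⟨ cong (λ n → suc n * blocks 2 x + 4) (∣p∣+∣∁p∣≡n x ∣x∣≡2) ⟩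
  _ ∎
  where open ≡-Reasoning

blocksSum : ∀ k s → ℕ
blocksSum k s = sumSubsets (double k) (λ y → δ (∣ y ∣) s * blocks 2 y)

blocksSum₀ : ∀ k → blocksSum k 0 ≡ 0
blocksSum₀ zero = refl
blocksSum₀ (suc k) = sumSubsets-by-block {k} (λ y → δ (∣ y ∣) 0 * blocks 2 y)
  (sumSubsets-zero (double k)) (sumSubsets-zero (double k)) (sumSubsets-zero (double k)) (blocksSum₀ k)

blocksSum₁ : ∀ k → blocksSum k 1 ≡ 0
blocksSum₁ zero = refl
blocksSum₁ (suc k) = sumSubsets-by-block {k} (λ y → δ (∣ y ∣) 1 * blocks 2 y)
  (sumSubsets-zero (double k)) (blocksSum₀ k) (blocksSum₀ k) (blocksSum₁ k)

blocksSum₂ : ∀ k → blocksSum k 2 ≡ k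
blocksSum₂ zero = refl
blocksSum₂ (suc k) = sumSubsets-by-block {k} (λ y → δ (∣ y ∣) 2 * blocks 2 y)
  (trans (sumSubsets-*suc (double k) (λ y → δ (∣ y ∣) 0) (blocks 2))
         (cong₂ _+_ (sumSubsets-size (double k) 0) (blocksSum₀ k)))
  (blocksSum₁ k) (blocksSum₁ k) (blocksSum₂ k)

blocksSum₃ : ∀ k → blocksSum k 3 ≡ 4 * choose₂ k
blocksSum₃ zero = refl
blocksSum₃ (suc k) = trans
  (sumSubsets-by-block {k} (λ y → δ (∣ y ∣) 3 * blocks 2 y)
    (trans (sumSubsets-*suc (double k) (λ y → δ (∣ y ∣) 1) (blocks 2))
           (cong₂ _+_ (trans (sumSubsets-size (double k) 1) (trans (nC1≡n (double k)) (double≡2* k))) (blocksSum₁ k)))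
    (blocksSum₂ k) (blocksSum₂ k) (blocksSum₃ k))
  (arith k (choose₂ k))
  where arith : ∀ k t → 2 * k + 0 + k + (k + 4 * t) ≡ 4 * (k + t)
        arith = solve-∀

2*choose₂+m≡m*m : ∀ m → 2 * choose₂ m + m ≡ m * m
2*choose₂+m≡m*m zero = refl
2*choose₂+m≡m*m (suc m) = begin
  2 * (m + choose₂ m) + suc m   ≡⟨ regroup m (choose₂ m) ⟩
  2 * m + 1 + (2 * choose₂ m + m) ≡⟨ cong (2 * m + 1 +_) (2*choose₂+m≡m*m m) ⟩
  2 * m + 1 + m * m             ≡⟨ square m ⟩
  suc m * suc m ∎
  where
  open ≡-Reasoning
  regroup : ∀ m t → 2 * (m + t) + suc m ≡ 2 * m + 1 + (2 * t + m)
  regroup = solve-∀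
  square : ∀ m → 2 * m + 1 + m * m ≡ suc m * suc m
  square = solve-∀

bound-even : ∀ k → bound (double k) ≡ 4 * choose₂ k
bound-even k = begin
  boundAux (double k) (double k % 2)
    ≡⟨ cong (boundAux (double k)) (trans (cong (_% 2) (trans (double≡2* k) (ℕ.*-comm 2 k))) (m*n%n≡0 k 2)) ⟩
  double k * (double k ∸ 2) / 2 ≡⟨ cong (_/ 2) (product k) ⟩
  4 * choose₂ k * 2 / 2         ≡⟨ m*n/n≡m (4 * choose₂ k) 2 ⟩
  4 * choose₂ k ∎
  where
  open ≡-Reasoning
  product : ∀ k → double k * (double k ∸ 2) ≡ 4 * choose₂ k * 2
  product zero = refl
  product (suc k) = begin
    (2 + double k) * double k     ≡⟨ cong (λ d → (2 + d) * d) (double≡2* k) ⟩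
    (2 + 2 * k) * (2 * k)         ≡⟨ expand k ⟩
    4 * k + 4 * (k * k)           ≡⟨ cong (λ s → 4 * k + 4 * s) (2*choose₂+m≡m*m k) ⟨
    4 * k + 4 * (2 * choose₂ k + k) ≡⟨ collect k (choose₂ k) ⟩
    4 * (k + choose₂ k) * 2 ∎
    where
    expand : ∀ k → (2 + 2 * k) * (2 * k) ≡ 4 * k + 4 * (k * k)
    expand = solve-∀
    collect : ∀ k t → 4 * k + 4 * (2 * t + k) ≡ 4 * (k + t) * 2
    collect = solve-∀

bound-odd : ∀ k → bound (suc (double k)) ≡ k + 4 * choose₂ k
bound-odd k = begin
  boundAux (suc (double k)) (suc (double k) % 2)
    ≡⟨ cong (boundAux (suc (double k))) (trans (cong (λ d → suc d % 2) (trans (double≡2* k) (ℕ.*-comm 2 k)))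
                                              ([m+kn]%n≡m%n 1 k 2)) ⟩
  double k * (double k ∸ 1) / 2 ≡⟨ cong (_/ 2) (product k) ⟩
  (k + 4 * choose₂ k) * 2 / 2   ≡⟨ m*n/n≡m (k + 4 * choose₂ k) 2 ⟩
  k + 4 * choose₂ k ∎
  where
  open ≡-Reasoning
  product : ∀ k → double k * (double k ∸ 1) ≡ (k + 4 * choose₂ k) * 2
  product zero = refl
  product (suc k) = begin
    (2 + double k) * (1 + double k)   ≡⟨ cong (λ d → (2 + d) * (1 + d)) (double≡2* k) ⟩
    (2 + 2 * k) * (1 + 2 * k)         ≡⟨ expand k ⟩
    2 + 6 * k + 4 * (k * k)           ≡⟨ cong (λ s → 2 + 6 * k + 4 * s) (2*choose₂+m≡m*m k) ⟨
    2 + 6 * k + 4 * (2 * choose₂ k + k) ≡⟨ collect k (choose₂ k) ⟩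
    (suc k + 4 * (k + choose₂ k)) * 2 ∎
    where
    expand : ∀ k → (2 + 2 * k) * (1 + 2 * k) ≡ 2 + 6 * k + 4 * (k * k)
    expand = solve-∀
    collect : ∀ k t → 2 + 6 * k + 4 * (2 * t + k) ≡ (suc k + 4 * (k + t)) * 2
    collect = solve-∀

evenWeight : ∀ k → Subset (double k) → ℕ
evenWeight k y = blocks 2 y * (double k ∸ 1)

evenWeight-vertex : ∀ k (x : Subset (double k)) → ∣ x ∣ ≡ 3 →
  shapeSum x 1 1 (evenWeight k) + 7 * evenWeight k x ≡ double k * evenWeight k x + 6 * (double k ∸ 1)
evenWeight-vertex k x ∣x∣≡3 = begin
  shapeSum x 1 1 (evenWeight k) + 7 * (blocks 2 x * c)
    ≡⟨ cong (_+ 7 * (blocks 2 x * c)) (shapeSum-affine x 1 1 0 (blocks 2) c) ⟩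
  (∣ x ∣ C 1) * (∣ ∁ x ∣ C 1) * 0 + shapeSum x 1 1 (blocks 2) * c + 7 * (blocks 2 x * c)
    ≡⟨ scale ((∣ x ∣ C 1) * (∣ ∁ x ∣ C 1)) (shapeSum x 1 1 (blocks 2)) (blocks 2 x) c ⟩
  (shapeSum x 1 1 (blocks 2) + 7 * blocks 2 x) * c
    ≡⟨ cong (_* c) (blocks-even-vertex x ∣x∣≡3) ⟩
  (double k * blocks 2 x + 6) * c
    ≡⟨ expand (double k) (blocks 2 x) c ⟩
  double k * (blocks 2 x * c) + 6 * c ∎
  where
  open ≡-Reasoning
  c = double k ∸ 1
  scale : ∀ z F q c → z * 0 + F * c + 7 * (q * c) ≡ (F + 7 * q) * c
  scale = solve-∀
  expand : ∀ n q c → (n * q + 6) * c ≡ n * (q * c) + 6 * c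
  expand = solve-∀

even-witness : ∀ j → let n = double (3 + j) in
  Σ (Subset n → ℚ) (λ v → InV2 n v × NoZeros n v × numNeg n v ≤ bound n)
even-witness j = threeMinus (evenWeight k)
  , (λ x x∈ → eigen-at x (∈J3vertices⇒∣x∣≡3 x∈) (evenWeight k) (evenWeight-vertex k x (∈J3vertices⇒∣x∣≡3 x∈)))
  , (λ y _ → threeMinus-nonzero 0 (blocks 2 y) (double k ∸ 1) (s≤s z≤n) 3<c)
  , ℕ.≤-trans (numNeg≤sum (double k) (threeMinus (evenWeight k)) (blocks 2)
                 (λ y → threeMinus-negative⇒1≤b 0 (blocks 2 y) (double k ∸ 1) (s≤s z≤n)))
              (ℕ.≤-reflexive (trans (blocksSum₃ k) (sym (bound-even k))))
  where
  k = 3 + j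
  3<c : 3 < double k ∸ 1
  3<c = s≤s (s≤s (s≤s (s≤s z≤n)))

apexWeight : Bool → ℕ
apexWeight true = 2
apexWeight false = 0

apexWeight<3 : ∀ a → apexWeight a < 3
apexWeight<3 true = s≤s (s≤s (s≤s z≤n))
apexWeight<3 false = s≤s z≤n

oddWeight : ∀ k → Subset (suc (double k)) → ℕ
oddWeight k (a ∷ y) = apexWeight a + blocks 2 y * (double k ∸ 1)

oddWeight-apex-vertex : ∀ k (x : Subset (double k)) → ∣ x ∣ ≡ 2 → let x₀ = true ∷ x in
  shapeSum x₀ 1 1 (oddWeight k) + 7 * oddWeight k x₀ ≡ suc (double k) * oddWeight k x₀ + 6 * double k
oddWeight-apex-vertex k x ∣x∣≡2 = begin
  shapeSum x 1 1 (λ y → 2 + blocks 2 y * c) + shapeSum x 0 1 (λ y → 0 + blocks 2 y * c) + 7 * (2 + q * c)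
    ≡⟨ cong₂ (λ a b → a + b + 7 * (2 + q * c)) (shapeSum-affine x 1 1 2 (blocks 2) c) (shapeSum-affine x 0 1 0 (blocks 2) c) ⟩
  (∣ x ∣ C 1) * (∣ ∁ x ∣ C 1) * 2 + shapeSum x 1 1 (blocks 2) * c
    + ((∣ x ∣ C 0) * (∣ ∁ x ∣ C 1) * 0 + shapeSum x 0 1 (blocks 2) * c) + 7 * (2 + q * c)
    ≡⟨ arith (double k) ∣ ∁ x ∣ ((∣ x ∣ C 1) * (∣ ∁ x ∣ C 1)) ((∣ x ∣ C 0) * (∣ ∁ x ∣ C 1)) q
               (shapeSum x 1 1 (blocks 2)) (shapeSum x 0 1 (blocks 2)) (∣p∣+∣∁p∣≡n x ∣x∣≡2) (trans (count₁₁ x) (cong (_* ∣ ∁ x ∣) ∣x∣≡2))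
             (blocks-apex-vertex x ∣x∣≡2) ⟩
  suc (double k) * (2 + q * c) + 6 * double k ∎
  where
  open ≡-Reasoning
  c = double k ∸ 1
  q = blocks 2 x
  arith : ∀ d o K z q F₁₁ F₀₁ → 2 + o ≡ d → K ≡ 2 * o → F₁₁ + F₀₁ + 7 * q ≡ suc d * q + 4 →
    K * 2 + F₁₁ * (d ∸ 1) + (z * 0 + F₀₁ * (d ∸ 1)) + 7 * (2 + q * (d ∸ 1)) ≡ suc d * (2 + q * (d ∸ 1)) + 6 * d
  arith .(2 + o) o .(2 * o) z q F₁₁ F₀₁ refl refl eq = begin
    2 * o * 2 + F₁₁ * (1 + o) + (z * 0 + F₀₁ * (1 + o)) + 7 * (2 + q * (1 + o))
      ≡⟨ regroup o z q F₁₁ F₀₁ ⟩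
    4 * o + 14 + (F₁₁ + F₀₁ + 7 * q) * (1 + o)
      ≡⟨ cong (λ m → 4 * o + 14 + m * (1 + o)) eq ⟩
    4 * o + 14 + ((3 + o) * q + 4) * (1 + o)
      ≡⟨ collect o q ⟩
    (3 + o) * (2 + q * (1 + o)) + 6 * (2 + o) ∎
    where
    regroup : ∀ o z q F₁₁ F₀₁ → 2 * o * 2 + F₁₁ * (1 + o) + (z * 0 + F₀₁ * (1 + o)) + 7 * (2 + q * (1 + o))
                                 ≡ 4 * o + 14 + (F₁₁ + F₀₁ + 7 * q) * (1 + o)
    regroup = solve-∀
    collect : ∀ o q → 4 * o + 14 + ((3 + o) * q + 4) * (1 + o) ≡ (3 + o) * (2 + q * (1 + o)) + 6 * (2 + o)
    collect = solve-∀
oddWeight-other-vertex : ∀ k (x : Subset (double k)) → ∣ x ∣ ≡ 3 → let x₀ = false ∷ x in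
  shapeSum x₀ 1 1 (oddWeight k) + 7 * oddWeight k x₀ ≡ suc (double k) * oddWeight k x₀ + 6 * double k
oddWeight-other-vertex k x ∣x∣≡3 = begin
  shapeSum x 1 0 (λ y → 2 + blocks 2 y * c) + shapeSum x 1 1 (λ y → 0 + blocks 2 y * c) + 7 * (0 + q * c)
    ≡⟨ cong₂ (λ a b → a + b + 7 * (q * c)) (shapeSum-affine x 1 0 2 (blocks 2) c) (shapeSum-affine x 1 1 0 (blocks 2) c) ⟩
  (∣ x ∣ C 1) * (∣ ∁ x ∣ C 0) * 2 + shapeSum x 1 0 (blocks 2) * c
    + ((∣ x ∣ C 1) * (∣ ∁ x ∣ C 1) * 0 + shapeSum x 1 1 (blocks 2) * c) + 7 * (q * c)
    ≡⟨ arith (double k) ∣ ∁ x ∣ ((∣ x ∣ C 1) * (∣ ∁ x ∣ C 0)) ((∣ x ∣ C 1) * (∣ ∁ x ∣ C 1)) q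
               (shapeSum x 1 0 (blocks 2)) (shapeSum x 1 1 (blocks 2)) (∣p∣+∣∁p∣≡n x ∣x∣≡3) (trans (count₁₀ x) ∣x∣≡3) (blocks-odd-vertex x ∣x∣≡3) ⟩
  suc (double k) * (q * c) + 6 * double k ∎
  where
  open ≡-Reasoning
  c = double k ∸ 1
  q = blocks 2 x
  arith : ∀ d o K z q F₁₀ F₁₁ → 3 + o ≡ d → K ≡ 3 → F₁₀ + F₁₁ + 7 * q ≡ suc d * q + 6 →
    K * 2 + F₁₀ * (d ∸ 1) + (z * 0 + F₁₁ * (d ∸ 1)) + 7 * (q * (d ∸ 1)) ≡ suc d * (q * (d ∸ 1)) + 6 * d
  arith .(3 + o) o .3 z q F₁₀ F₁₁ refl refl eq = begin
    3 * 2 + F₁₀ * (2 + o) + (z * 0 + F₁₁ * (2 + o)) + 7 * (q * (2 + o))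
      ≡⟨ regroup o z q F₁₀ F₁₁ ⟩
    6 + (F₁₀ + F₁₁ + 7 * q) * (2 + o)
      ≡⟨ cong (λ m → 6 + m * (2 + o)) eq ⟩
    6 + ((4 + o) * q + 6) * (2 + o)
      ≡⟨ collect o q ⟩
    (4 + o) * (q * (2 + o)) + 6 * (3 + o) ∎
    where
    regroup : ∀ o z q F₁₀ F₁₁ → 3 * 2 + F₁₀ * (2 + o) + (z * 0 + F₁₁ * (2 + o)) + 7 * (q * (2 + o))
                                 ≡ 6 + (F₁₀ + F₁₁ + 7 * q) * (2 + o)
    regroup = solve-∀
    collect : ∀ o q → 6 + ((4 + o) * q + 6) * (2 + o) ≡ (4 + o) * (q * (2 + o)) + 6 * (3 + o)
    collect = solve-∀

oddWeight-vertex : ∀ k (x : Subset (suc (double k))) → ∣ x ∣ ≡ 3 →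
  shapeSum x 1 1 (oddWeight k) + 7 * oddWeight k x ≡ suc (double k) * oddWeight k x + 6 * double k
oddWeight-vertex k (true ∷ x) ∣x∣≡3 = oddWeight-apex-vertex k x (ℕ.suc-injective ∣x∣≡3)
oddWeight-vertex k (false ∷ x) ∣x∣≡3 = oddWeight-other-vertex k x ∣x∣≡3

odd-witness : ∀ j → let n = suc (double (3 + j)) in
  Σ (Subset n → ℚ) (λ v → InV2 n v × NoZeros n v × numNeg n v ≤ bound n)
odd-witness j = threeMinus (oddWeight k)
  , (λ x x∈ → eigen-at x (∈J3vertices⇒∣x∣≡3 x∈) (oddWeight k) (oddWeight-vertex k x (∈J3vertices⇒∣x∣≡3 x∈)))
  , (λ { (a ∷ y) _ → threeMinus-nonzero (apexWeight a) (blocks 2 y) (double k ∸ 1) (apexWeight<3 a) 3<c })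
  , ℕ.≤-trans (numNeg≤sum (suc (double k)) (threeMinus (oddWeight k)) blocksOfTail negative⇒)
              (ℕ.≤-reflexive (trans (cong₂ _+_ (blocksSum₂ k) (blocksSum₃ k)) (sym (bound-odd k))))
  where
  k = 3 + j
  3<c : 3 < double k ∸ 1
  3<c = s≤s (s≤s (s≤s (s≤s z≤n)))
  blocksOfTail : Subset (suc (double k)) → ℕ
  blocksOfTail (_ ∷ y) = blocks 2 y
  negative⇒ : ∀ y → threeMinus (oddWeight k) y ℚ.< 0ℚ → 1 ≤ blocksOfTail y
  negative⇒ (a ∷ y) = threeMinus-negative⇒1≤b (apexWeight a) (blocks 2 y) (double k ∸ 1) (apexWeight<3 a)

theorem3 : (n : ℕ) → 6 ≤ n →
    Σ (Subset n → ℚ) (λ v → InV2 n v × NoZeros n v × numNeg n v ≤ bound n)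
theorem3 n 6≤n with ℕ.m≤n⇒∃[o]m+o≡n 6≤n
... | m , refl with parity m
...   | inj₁ (j , refl) = even-witness j
...   | inj₂ (j , refl) = odd-witness j
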